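{- Let $P$ be a PLSC of order $n$ whose dot structure is a minimum candidate structure, and let $\mathcal{B}$ be a BUG of $P$. Then $\mathcal{B}$ has either exactly $0$ or exactly $2$ solutions.
   Context: A PLSC (partial Latin super cube) of order $n$ is an assignment to each cell of $\{1,\ldots,n\}^3$ of one of three states: rook, dot, or empty, such that no two rooks lie on a common line (a line, or file, is a set of $n$ cells obtained by fixing two coordinates), and such that no line containing a rook contains a dot. The dot structure is a minimum candidate structure (mCS) if every line containing no rook contains exactly two dots. Form the graph whose vertices are the dots of $P$, two dots being adjacent iff they lie on a common line. A BUG (Bivalue Universal Grave) is the set of dots of a connected component of this graph. The files of a BUG are the lines containing at least one of its dots. A solution of a BUG is a set consisting of half of the dots of the BUG such that each file of the BUG contains exactly one dot of the set (i.e. these dots can be replaced by rooks giving exactly one rook in each file of the BUG). -}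

module Defs where

open import Data.Nat using (ℕ; zero; suc; _+_; _*_)
open import Data.Fin using (Fin; zero; suc)
open import Data.Bool using (Bool; true; false)
open import Data.Product using (_×_; _,_; ∃; ∃-syntax)
open import Relation.Binary.PropositionalEquality using (_≡_; _≢_)
open import Relation.Nullary using (¬_)

data State : Set where
  rook dot empty : State

-- Cells of {1..n}^3 (0-indexed).
Cell : ℕ → Set
Cell n = Fin n × Fin n × Fin n

Assignment : ℕ → Set
Assignment n = Cell n → State

-- Lines (files): the free coordinate and the two fixed coordinates.
data Dir : Set where
  dx dy dz : Dir

Line : ℕ → Set
Line n = Dir × Fin n × Fin n

lineCell : ∀ {n} → Line n → Fin n → Cell n
lineCell (dx , a , b) t = (t , a , b)
lineCell (dy , a , b) t = (a , t , b)
lineCell (dz , a , b) t = (a , b , t)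

OnLine : ∀ {n} → Line n → Cell n → Set
OnLine L c = ∃[ t ] lineCell L t ≡ c

sumFin : ∀ {n} → (Fin n → ℕ) → ℕ
sumFin {zero}  f = 0
sumFin {suc n} f = f zero + sumFin (λ i → f (suc i))

isDot : State → ℕ
isDot dot = 1
isDot _   = 0

b2n : Bool → ℕ
b2n true  = 1
b2n false = 0

LineHasRook : ∀ {n} → Assignment n → Line n → Set
LineHasRook P L = ∃[ t ] P (lineCell L t) ≡ rook

LineHasDot : ∀ {n} → Assignment n → Line n → Set
LineHasDot P L = ∃[ t ] P (lineCell L t) ≡ dot

dotsOnLine : ∀ {n} → Assignment n → Line n → ℕ
dotsOnLine P L = sumFin (λ t → isDot (P (lineCell L t)))

record IsPLSC {n} (P : Assignment n) : Set where
  field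
    rooksNonAttacking : ∀ (L : Line n) (c d : Cell n) → OnLine L c → OnLine L d →
                        P c ≡ rook → P d ≡ rook → c ≡ d
    rookLineNoDot     : ∀ (L : Line n) → LineHasRook P L → ¬ LineHasDot P L

IsMCS : ∀ {n} → Assignment n → Set
IsMCS {n} P = ∀ (L : Line n) → ¬ LineHasRook P L → dotsOnLine P L ≡ 2

Adjacent : ∀ {n} → Assignment n → Cell n → Cell n → Set
Adjacent {n} P c d = P c ≡ dot × P d ≡ dot × c ≢ d × ∃[ L ] (OnLine L c × OnLine L d)

data Connected {n} (P : Assignment n) : Cell n → Cell n → Set where
  here  : ∀ {c} → Connected P c c
  there : ∀ {c d e} → Connected P c d → Adjacent P d e → Connected P c e

CellSet : ℕ → Set
CellSet n = Cell n → Bool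

_∈ₛ_ : ∀ {n} → Cell n → CellSet n → Set
c ∈ₛ B = B c ≡ true

card : ∀ {n} → CellSet n → ℕ
card S = sumFin (λ i → sumFin (λ j → sumFin (λ k → b2n (S (i , j , k)))))

onLineCount : ∀ {n} → CellSet n → Line n → ℕ
onLineCount S L = sumFin (λ t → b2n (S (lineCell L t)))

-- B is a BUG of P: the vertex set of a connected component of the dot graph.
record IsBUG {n} (P : Assignment n) (B : CellSet n) : Set where
  field
    nonempty  : ∃[ c ] c ∈ₛ B
    allDots   : ∀ c → c ∈ₛ B → P c ≡ dot
    closed    : ∀ c d → c ∈ₛ B → Adjacent P c d → d ∈ₛ B
    connected : ∀ c d → c ∈ₛ B → d ∈ₛ B → Connected P c d

IsFileOf : ∀ {n} → CellSet n → Line n → Set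
IsFileOf B L = ∃[ t ] lineCell L t ∈ₛ B

record IsSolution {n} (B S : CellSet n) : Set where
  field
    subset  : ∀ c → c ∈ₛ S → c ∈ₛ B
    half    : 2 * card S ≡ card B
    oneEach : ∀ (L : Line n) → IsFileOf B L → onLineCount S L ≡ 1

_≐_ : ∀ {n} → CellSet n → CellSet n → Set
S ≐ T = ∀ c → S c ≡ T c

-- Fix a dot c₀ of the BUG. Every file of the BUG contains exactly two dots, and both belong to
-- the BUG, so a solution meets each file in one of its two dots: the complement in the BUG of a
-- solution is again a solution, and along every edge of the dot graph a solution contains exactly
-- one endpoint. By connectedness a solution is therefore determined by whether it contains c₀.
-- Solutions are decidable (the BUG is a finite set), so either there is none, or there is one,
-- S, and then S and its complement are the only two.
module Submission where

open import Defs
open import Algebra.Properties.CommutativeSemigroup using (interchange)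
open import Data.Bool using (true; false; _∧_; not)
open import Data.Bool.Properties using (not-¬; ¬-not) renaming (_≟_ to _≟ᵇ_)
open import Data.Empty using (⊥; ⊥-elim)
open import Data.Fin using (Fin; zero; suc; combine; remQuot)
open import Data.Fin.Properties using (all?; any?; remQuot-combine) renaming (_≟_ to _≟ᶠ_)
open import Data.Fin.Subset using (Subset)
open import Data.Fin.Subset.Properties using (anySubset?)
open import Data.Nat using (ℕ; zero; suc; _+_; _*_; _≤_; s≤s)
open import Data.Nat.Properties
  using (≤-refl; ≤-trans; +-mono-≤; m≤m+n; m≤n+m; +-comm; +-cancelˡ-≡; +-identityʳ; +-commutativeSemigroup)
  renaming (_≟_ to _≟ℕ_)
open import Data.Product using (_×_; _,_; ∃-syntax; proj₁; proj₂)
open import Data.Sum using (_⊎_; inj₁; inj₂)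
open import Data.Vec using (lookup; tabulate)
open import Data.Vec.Properties using (lookup∘tabulate)
open import Relation.Nullary using (¬_; Dec; yes; no)
open import Relation.Nullary.Decidable using (map′; _×-dec_; _→-dec_)
open import Relation.Binary.PropositionalEquality
  using (_≡_; _≢_; refl; sym; trans; cong; cong₂; subst; module ≡-Reasoning)

sumFin-cong : ∀ {n} {f g : Fin n → ℕ} → (∀ t → f t ≡ g t) → sumFin f ≡ sumFin g
sumFin-cong {zero}  f≗g = refl
sumFin-cong {suc n} f≗g = cong₂ _+_ (f≗g zero) (sumFin-cong (λ t → f≗g (suc t)))

sumFin-+ : ∀ {n} (f g : Fin n → ℕ) → sumFin (λ t → f t + g t) ≡ sumFin f + sumFin g
sumFin-+ {zero}  f g = refl
sumFin-+ {suc n} f g = begin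
  f zero + g zero + sumFin (λ t → f (suc t) + g (suc t))
    ≡⟨ cong (f zero + g zero +_) (sumFin-+ (λ t → f (suc t)) (λ t → g (suc t))) ⟩
  f zero + g zero + (sumFin (λ t → f (suc t)) + sumFin (λ t → g (suc t)))
    ≡⟨ interchange +-commutativeSemigroup (f zero) (g zero) _ _ ⟩
  f zero + sumFin (λ t → f (suc t)) + (g zero + sumFin (λ t → g (suc t))) ∎
  where open ≡-Reasoning

≤-sumFin : ∀ {n} (f : Fin n → ℕ) (i : Fin n) → f i ≤ sumFin f
≤-sumFin f zero    = m≤m+n _ _
≤-sumFin f (suc i) = ≤-trans (≤-sumFin (λ t → f (suc t)) i) (m≤n+m _ _)

pair-≤-sumFin : ∀ {n} (f : Fin n → ℕ) {i j : Fin n} → i ≢ j → f i + f j ≤ sumFin f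
pair-≤-sumFin f {zero}  {zero}  i≢j = ⊥-elim (i≢j refl)
pair-≤-sumFin f {zero}  {suc j} i≢j = +-mono-≤ ≤-refl (≤-sumFin (λ t → f (suc t)) j)
pair-≤-sumFin f {suc i} {zero}  i≢j =
  subst (_≤ sumFin f) (+-comm (f zero) (f (suc i))) (+-mono-≤ ≤-refl (≤-sumFin (λ t → f (suc t)) i))
pair-≤-sumFin f {suc i} {suc j} i≢j =
  ≤-trans (pair-≤-sumFin (λ t → f (suc t)) (λ i≡j → i≢j (cong suc i≡j))) (m≤n+m _ _)

lineCell-injective : ∀ {n} (L : Line n) {t u : Fin n} → lineCell L t ≡ lineCell L u → t ≡ u
lineCell-injective (dx , _ , _) eq = cong proj₁ eq
lineCell-injective (dy , _ , _) eq = cong (λ c → proj₁ (proj₂ c)) eq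
lineCell-injective (dz , _ , _) eq = cong (λ c → proj₂ (proj₂ c)) eq

_⊆ₛ_ : ∀ {n} → CellSet n → CellSet n → Set
S ⊆ₛ B = ∀ c → c ∈ₛ S → c ∈ₛ B

infixl 30 _∖_

_∖_ : ∀ {n} → CellSet n → CellSet n → CellSet n
(B ∖ S) c = B c ∧ not (S c)

∖-⊆ : ∀ {n} (B S : CellSet n) → (B ∖ S) ⊆ₛ B
∖-⊆ B S c c∈B∖S with B c
... | true  = refl
... | false = c∈B∖S

∖-of-∈ : ∀ {n} (B S : CellSet n) {c} → c ∈ₛ B → (B ∖ S) c ≡ not (S c)
∖-of-∈ B S c∈B rewrite c∈B = refl

b2n-∖ : ∀ {n} {B S : CellSet n} → S ⊆ₛ B → ∀ c → b2n (B c) ≡ b2n (S c) + b2n ((B ∖ S) c)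
b2n-∖ {B = B} {S} S⊆B c with B c in Bc | S c in Sc
... | true  | true  = refl
... | true  | false = refl
... | false | false = refl
... | false | true  with () ← trans (sym Bc) (S⊆B c Sc)

card-additive : ∀ {n} {X Y Z : CellSet n} → (∀ c → b2n (X c) ≡ b2n (Y c) + b2n (Z c)) →
                card X ≡ card Y + card Z
card-additive {Y = Y} {Z} X≗Y+Z =
  trans (sumFin-cong λ i → trans (sumFin-cong λ j →
          trans (sumFin-cong λ k → X≗Y+Z (i , j , k)) (sumFin-+ (Yᵢⱼ i j) (Zᵢⱼ i j)))
        (sumFin-+ (λ j → sumFin (Yᵢⱼ i j)) (λ j → sumFin (Zᵢⱼ i j))))
    (sumFin-+ (λ i → sumFin (λ j → sumFin (Yᵢⱼ i j))) (λ i → sumFin (λ j → sumFin (Zᵢⱼ i j))))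
  where
  Yᵢⱼ Zᵢⱼ : _ → _ → _ → ℕ
  Yᵢⱼ i j k = b2n (Y (i , j , k))
  Zᵢⱼ i j k = b2n (Z (i , j , k))

onLineCount-additive : ∀ {n} {X Y Z : CellSet n} → (∀ c → b2n (X c) ≡ b2n (Y c) + b2n (Z c)) →
                       ∀ L → onLineCount X L ≡ onLineCount Y L + onLineCount Z L
onLineCount-additive {Y = Y} {Z} X≗Y+Z L =
  trans (sumFin-cong (λ t → X≗Y+Z (lineCell L t)))
        (sumFin-+ (λ t → b2n (Y (lineCell L t))) (λ t → b2n (Z (lineCell L t))))

onLineCount≡1⇒unique : ∀ {n} (X : CellSet n) (L : Line n) {i j : Fin n} → onLineCount X L ≡ 1 →
                       i ≢ j → lineCell L i ∈ₛ X → ¬ lineCell L j ∈ₛ X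
onLineCount≡1⇒unique X L {i} {j} count≡1 i≢j i∈X j∈X
  with pair-≤-sumFin (λ t → b2n (X (lineCell L t))) i≢j
... | two≤count rewrite i∈X | j∈X | count≡1 with s≤s () ← two≤count

encodeCell : ∀ {n} → Cell n → Fin (n * (n * n))
encodeCell (i , j , k) = combine i (combine j k)

decodeCell : ∀ {n} → Fin (n * (n * n)) → Cell n
decodeCell {n} x = splitRow (remQuot (n * n) x)
  where
  splitRow : Fin n × Fin (n * n) → Cell n
  splitRow (i , y) = i , remQuot n y

decode-encodeCell : ∀ {n} (c : Cell n) → decodeCell (encodeCell c) ≡ c
decode-encodeCell {n} (i , j , k) =
  trans (cong (λ (i′ , y) → i′ , remQuot n y) (remQuot-combine {k = n * n} i (combine j k)))
        (cong (i ,_) (remQuot-combine {k = n} j k))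

allCell? : ∀ {n} {Q : Cell n → Set} → (∀ c → Dec (Q c)) → Dec (∀ c → Q c)
allCell? {Q = Q} Q? =
  map′ (λ ∀Q c → subst Q (decode-encodeCell c) (∀Q (encodeCell c))) (λ ∀Q x → ∀Q (decodeCell x))
       (all? (λ x → Q? (decodeCell x)))

allLine? : ∀ {n} {Q : Line n → Set} → (∀ L → Dec (Q L)) → Dec (∀ L → Q L)
allLine? {Q = Q} Q? = map′ fromDirs toDirs (inDir? dx ×-dec inDir? dy ×-dec inDir? dz)
  where
  inDir? : ∀ d → Dec (∀ a b → Q (d , a , b))
  inDir? d = all? (λ a → all? (λ b → Q? (d , a , b)))
  fromDirs : _ → ∀ L → Q L
  fromDirs (Qx , _ , _) (dx , a , b) = Qx a b
  fromDirs (_ , Qy , _) (dy , a , b) = Qy a b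
  fromDirs (_ , _ , Qz) (dz , a , b) = Qz a b
  toDirs : (∀ L → Q L) → _
  toDirs ∀Q = (λ a b → ∀Q (dx , a , b)) , (λ a b → ∀Q (dy , a , b)) , (λ a b → ∀Q (dz , a , b))

isSolution? : ∀ {n} (B S : CellSet n) → Dec (IsSolution B S)
isSolution? B S =
  map′ (λ (sub , half , one) → record { subset = sub ; half = half ; oneEach = one })
       (λ sol → IsSolution.subset sol , IsSolution.half sol , IsSolution.oneEach sol)
       (allCell? (λ c → (S c ≟ᵇ true) →-dec (B c ≟ᵇ true))
        ×-dec (2 * card S ≟ℕ card B)
        ×-dec allLine? (λ L → any? (λ t → B (lineCell L t) ≟ᵇ true) →-dec (onLineCount S L ≟ℕ 1)))

card-cong : ∀ {n} {S T : CellSet n} → S ≐ T → card S ≡ card T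
card-cong S≐T = sumFin-cong λ i → sumFin-cong λ j → sumFin-cong λ k → cong b2n (S≐T (i , j , k))

IsSolution-resp-≐ : ∀ {n} {B S T : CellSet n} → S ≐ T → IsSolution B S → IsSolution B T
IsSolution-resp-≐ {S = S} {T} S≐T sol = record
  { subset  = λ c c∈T → IsSolution.subset sol c (trans (S≐T c) c∈T)
  ; half    = trans (cong (2 *_) (sym (card-cong S≐T))) (IsSolution.half sol)
  ; oneEach = λ L file → trans (sumFin-cong (λ t → cong b2n (sym (S≐T (lineCell L t)))))
                               (IsSolution.oneEach sol L file)
  }

fromSubset : ∀ {n} → Subset (n * (n * n)) → CellSet n
fromSubset p c = lookup p (encodeCell c)

fromSubset-tabulate : ∀ {n} (S : CellSet n) → fromSubset (tabulate (λ x → S (decodeCell x))) ≐ S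
fromSubset-tabulate S c =
  trans (lookup∘tabulate (λ x → S (decodeCell x)) (encodeCell c)) (cong S (decode-encodeCell c))

∃-solution? : ∀ {n} (B : CellSet n) → Dec (∃[ S ] IsSolution B S)
∃-solution? B =
  map′ (λ (p , sol) → fromSubset p , sol)
       (λ (S , sol) → tabulate _ , IsSolution-resp-≐ (λ c → sym (fromSubset-tabulate S c)) sol)
       (anySubset? (λ p → isSolution? B (fromSubset p)))

exactly-one : ∀ {x y} → (x ≡ true → y ≡ true → ⊥) → (not x ≡ true → not y ≡ true → ⊥) → y ≡ not x
exactly-one {true}  {true}  ¬both ¬neither = ⊥-elim (¬both refl refl)
exactly-one {true}  {false} ¬both ¬neither = refl
exactly-one {false} {true}  ¬both ¬neither = refl
exactly-one {false} {false} ¬both ¬neither = ⊥-elim (¬neither refl refl)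

solution-outside : ∀ {n} {B S : CellSet n} {c} → IsSolution B S → B c ≡ false → S c ≡ false
solution-outside {S = S} {c} sol c∉B with S c in c∈S
... | false = refl
... | true  with () ← trans (sym c∉B) (IsSolution.subset sol c c∈S)

module BUGSolutions {n} {P : Assignment n} (plsc : IsPLSC P) (mcs : IsMCS P)
                    {B : CellSet n} (bug : IsBUG P B) where
  open IsBUG bug

  dot-on-file∈B : ∀ L {t u} → lineCell L t ∈ₛ B → P (lineCell L u) ≡ dot → lineCell L u ∈ₛ B
  dot-on-file∈B L {t} {u} t∈B u-dot with t ≟ᶠ u
  ... | yes refl = t∈B
  ... | no  t≢u  = closed _ _ t∈B
    (allDots _ t∈B , u-dot , (λ eq → t≢u (lineCell-injective L eq)) , L , (t , refl) , (u , refl))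

  fileCount≡dotsOnLine : ∀ L → IsFileOf B L → onLineCount B L ≡ dotsOnLine P L
  fileCount≡dotsOnLine L (t , t∈B) = sumFin-cong onFile
    where
    onFile : ∀ u → b2n (B (lineCell L u)) ≡ isDot (P (lineCell L u))
    onFile u with P (lineCell L u) in Pu | B (lineCell L u) in u∈B
    ... | dot   | true  = refl
    ... | rook  | false = refl
    ... | empty | false = refl
    ... | dot   | false with () ← trans (sym u∈B) (dot-on-file∈B L t∈B Pu)
    ... | rook  | true  with () ← trans (sym Pu) (allDots _ u∈B)
    ... | empty | true  with () ← trans (sym Pu) (allDots _ u∈B)

  fileCount≡2 : ∀ L → IsFileOf B L → onLineCount B L ≡ 2
  fileCount≡2 L file@(t , t∈B) = trans (fileCount≡dotsOnLine L file) (mcs L noRook)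
    where
    noRook : ¬ LineHasRook P L
    noRook hasRook = IsPLSC.rookLineNoDot plsc L hasRook (t , allDots _ t∈B)

  ∖-isSolution : ∀ {S} → IsSolution B S → IsSolution B (B ∖ S)
  ∖-isSolution {S} sol = record
    { subset  = ∖-⊆ B S
    ; half    = trans (cong (2 *_) card-∖≡card) (IsSolution.half sol)
    ; oneEach = λ L file → +-cancelˡ-≡ 1 _ _ (begin
        1 + onLineCount (B ∖ S) L
          ≡⟨ cong (_+ onLineCount (B ∖ S) L) (IsSolution.oneEach sol L file) ⟨
        onLineCount S L + onLineCount (B ∖ S) L
          ≡⟨ onLineCount-additive {X = B} {S} {B ∖ S} split L ⟨
        onLineCount B L
          ≡⟨ fileCount≡2 L file ⟩
        2 ∎)
    }
    where
    open ≡-Reasoning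
    split : ∀ c → b2n (B c) ≡ b2n (S c) + b2n ((B ∖ S) c)
    split = b2n-∖ (IsSolution.subset sol)
    card-∖≡card : card (B ∖ S) ≡ card S
    card-∖≡card = +-cancelˡ-≡ (card S) _ _ (begin
      card S + card (B ∖ S) ≡⟨ card-additive {X = B} {S} {B ∖ S} split ⟨
      card B                ≡⟨ IsSolution.half sol ⟨
      2 * card S            ≡⟨ cong (card S +_) (+-identityʳ (card S)) ⟩
      card S + card S       ∎)

  solution-alternates : ∀ {S d e} → IsSolution B S → d ∈ₛ B → Adjacent P d e → S e ≡ not (S d)
  solution-alternates {S} sol d∈B adj@(_ , _ , d≢e , L , (i , refl) , (j , refl)) =
    exactly-one
      (onLineCount≡1⇒unique S L (IsSolution.oneEach sol L file) i≢j)
      (λ ¬d∈S ¬e∈S → onLineCount≡1⇒unique (B ∖ S) L (IsSolution.oneEach (∖-isSolution sol) L file) i≢j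
         (trans (∖-of-∈ B S d∈B) ¬d∈S) (trans (∖-of-∈ B S (closed _ _ d∈B adj)) ¬e∈S))
    where
    file : IsFileOf B L
    file = i , d∈B
    i≢j : i ≢ j
    i≢j refl = d≢e refl

  connected-∈ : ∀ {c d} → c ∈ₛ B → Connected P c d → d ∈ₛ B
  connected-∈ c∈B here            = c∈B
  connected-∈ c∈B (there path adj) = closed _ _ (connected-∈ c∈B path) adj

  solutions-agree-along : ∀ {S T c d} → IsSolution B S → IsSolution B T → c ∈ₛ B →
                          Connected P c d → S c ≡ T c → S d ≡ T d
  solutions-agree-along solS solT c∈B here            Sc≡Tc = Sc≡Tc
  solutions-agree-along solS solT c∈B (there path adj) Sc≡Tc = begin
    _ ≡⟨ solution-alternates solS (connected-∈ c∈B path) adj ⟩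
    not _ ≡⟨ cong not (solutions-agree-along solS solT c∈B path Sc≡Tc) ⟩
    not _ ≡⟨ solution-alternates solT (connected-∈ c∈B path) adj ⟨
    _     ∎
    where open ≡-Reasoning

  solutions-agree : ∀ {S T c} → IsSolution B S → IsSolution B T → c ∈ₛ B → S c ≡ T c → S ≐ T
  solutions-agree {c = c} solS solT c∈B Sc≡Tc d with B d in d∈B
  ... | true  = solutions-agree-along solS solT c∈B (connected c d c∈B d∈B) Sc≡Tc
  ... | false = trans (solution-outside solS d∈B) (sym (solution-outside solT d∈B))

  solution-or-complement : ∀ {S₁ S c} → IsSolution B S₁ → IsSolution B S → c ∈ₛ B →
                           (S ≐ S₁) ⊎ (S ≐ B ∖ S₁)
  solution-or-complement {S₁} {S} {c} sol₁ sol c∈B with S c ≟ᵇ S₁ c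
  ... | yes agree    = inj₁ (solutions-agree sol sol₁ c∈B agree)
  ... | no  disagree = inj₂ (solutions-agree sol (∖-isSolution sol₁) c∈B
                              (trans (¬-not disagree) (sym (∖-of-∈ B S₁ c∈B))))

mainTheorem7 : ∀ (n : ℕ) (P : Assignment n) → IsPLSC P → IsMCS P →
    ∀ (B : CellSet n) → IsBUG P B →
    (∀ S → ¬ IsSolution B S)
    ⊎ (∃[ S₁ ] ∃[ S₂ ] (IsSolution B S₁ × IsSolution B S₂ × ¬ (S₁ ≐ S₂)
         × (∀ S → IsSolution B S → (S ≐ S₁) ⊎ (S ≐ S₂))))
mainTheorem7 n P plsc mcs B bug with ∃-solution? B | IsBUG.nonempty bug
... | no  ¬solvable    | _          = inj₁ (λ S sol → ¬solvable (S , sol))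
... | yes (S₁ , sol₁) | (c₀ , c₀∈B) =
  inj₂ (S₁ , B ∖ S₁ , sol₁ , ∖-isSolution sol₁ , S₁≢B∖S₁
       , λ S sol → solution-or-complement sol₁ sol c₀∈B)
  where
  open BUGSolutions plsc mcs bug
  S₁≢B∖S₁ : ¬ (S₁ ≐ B ∖ S₁)
  S₁≢B∖S₁ S₁≐B∖S₁ = not-¬ refl (trans (S₁≐B∖S₁ c₀) (∖-of-∈ B S₁ c₀∈B))
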